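{- Let $f,g\colon\omega\to\omega$ be bijections, and assume that $f\circ g$ has only finite orbits and, for every $n<\omega$, only finitely many orbits of length $n$. Then $g\circ f$ has only finite orbits, for every $n<\omega$ only finitely many orbits of length $n$, and $o^\dagger_{f\circ g}=o^\dagger_{g\circ f}$.
   Context: For a bijection $h\colon\omega\to\omega$ and $n<\omega$, the orbit $O_h(n)$ is the smallest set containing $n$ closed under $h$ and $h^{ -1}$; $\mathcal{O}_h=\{O_h(n):n<\omega\}$. Let $\langle p_n:n<\omega\rangle$ be the increasing enumeration of the primes. If $h$ has only finite orbits and only finitely many orbits of each length, $o^\dagger_h\colon\omega\to2$ is defined by $o^\dagger_h(n)=|\{O\in\mathcal{O}_h:|O|=p_n\}|\bmod 2$. -}

module Defs where

open import Data.Nat using (ℕ; zero; suc; _<_)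
open import Data.Nat.Primality using (Prime; prime?)
open import Data.List using (List; length; filter; upTo)
open import Data.List.Membership.Propositional using (_∈_)
open import Data.List.Relation.Unary.Unique.Propositional using (Unique)
open import Data.List.Relation.Unary.All using (All)
open import Data.List.Relation.Unary.AllPairs using (AllPairs)
open import Data.Product using (Σ; ∃; _×_)
open import Data.Sum using (_⊎_)
open import Relation.Nullary using (¬_)
open import Relation.Binary.PropositionalEquality using (_≡_)

iter : (ℕ → ℕ) → ℕ → ℕ → ℕ
iter h zero    n = n
iter h (suc k) n = h (iter h k n)

-- m ∈ O_h(n): m = h^k(n) or m = h^{-k}(n) (i.e. h^k(m) = n), for some k.
-- For a bijection h this is exactly the smallest set containing n closed
-- under h and h⁻¹.
InOrbit : (ℕ → ℕ) → ℕ → ℕ → Set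
InOrbit h n m = ∃ λ k → (iter h k n ≡ m) ⊎ (iter h k m ≡ n)

HasSize : (ℕ → Set) → ℕ → Set
HasSize P c = Σ (List ℕ) λ xs →
  Unique xs × (∀ m → (m ∈ xs → P m) × (P m → m ∈ xs)) × (length xs ≡ c)

AllOrbitsFinite : (ℕ → ℕ) → Set
AllOrbitsFinite h = ∀ n → ∃ λ c → HasSize (InOrbit h n) c

FinitelyManyOrbitsOfEachLength : (ℕ → ℕ) → Set
FinitelyManyOrbitsOfEachLength h = ∀ c → Σ (List ℕ) λ rs →
  ∀ m → HasSize (InOrbit h m) c → ∃ λ r → (r ∈ rs) × InOrbit h r m

NumOrbitsOfLength : (ℕ → ℕ) → ℕ → ℕ → Set
NumOrbitsOfLength h c N = Σ (List ℕ) λ rs →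
  All (λ r → HasSize (InOrbit h r) c) rs ×
  AllPairs (λ r s → ¬ InOrbit h r s) rs ×
  (∀ m → HasSize (InOrbit h m) c → ∃ λ r → (r ∈ rs) × InOrbit h r m) ×
  (length rs ≡ N)

primesBelow : ℕ → ℕ
primesBelow p = length (filter prime? (upTo p))

-- p is p_i, the i-th prime (0-indexed: p_0 = 2)
IsNthPrime : ℕ → ℕ → Set
IsNthPrime i p = Prime p × (primesBelow p ≡ i)

{-# OPTIONS --safe #-}
-- Since g ∘ (f ∘ g) = (g ∘ f) ∘ g, the bijection g conjugates f ∘ g to g ∘ f, and a
-- conjugacy maps the orbits of one map bijectively onto those of the other, preserving
-- sizes. Hence finiteness of orbits and of the number of orbits of each length transfer,
-- and f ∘ g and g ∘ f have the same number of orbits of each length p (prime or not),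
-- so the parities agree trivially. That number is well defined because the orbits of an
-- injection are the classes of an equivalence relation, and two duplicate-free lists of
-- representatives of the same classes are mutually included, hence of equal length.
module Submission where

open import Defs
open import Data.Nat using (ℕ; _%_; zero; suc; _+_; _≤_)
open import Data.Nat.Properties using (≤-antisym; ≤-total; +-comm; m≤n⇒∃[o]m+o≡n)
open import Data.Product using (_×_; _,_; proj₁; proj₂; ∃; ∃₂; map₂)
open import Data.Sum using (inj₁; inj₂)
open import Data.List using (List; map; length)
open import Data.List.Properties using (length-map)
open import Data.List.Membership.Propositional using (_∈_)
open import Data.List.Membership.Propositional.Properties using (∈-map⁺; ∈-map⁻)
open import Data.List.Relation.Unary.Any using (here; there)
open import Data.List.Relation.Unary.All using (All)
import Data.List.Relation.Unary.All as All
import Data.List.Relation.Unary.All.Properties as All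
open import Data.List.Relation.Unary.AllPairs using (AllPairs; []; _∷_)
import Data.List.Relation.Unary.AllPairs as AllPairs
import Data.List.Relation.Unary.AllPairs.Properties as AllPairs
import Data.List.Relation.Unary.Unique.Propositional.Properties as Unique
import Data.List.Fresh as List#
open import Data.List.Fresh.Relation.Unary.Any using (here; there)
import Data.List.Fresh.Membership.Setoid as Membership#
open import Data.List.Fresh.Membership.Setoid.Properties using (injection)
import Data.List.Membership.Setoid as SetoidMembership
import Data.List.Membership.Propositional as Membership
import Data.List.Relation.Binary.Subset.Setoid as SetoidSubset
import Data.List.Relation.Unary.Unique.Setoid as SetoidUnique
open import Function using (_⤖_; _↔_; _⇔_; mk⇔; Bijection; Inverse; Injection; Equivalence; Injective; _∘_; id)
open import Function.Properties.Bijection using (⤖⇒↔)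
open import Function.Properties.Inverse using (↔-sym; ↔⇒↣)
open import Level using (0ℓ)
open import Relation.Binary.Bundles using (Setoid)
open import Relation.Binary.PropositionalEquality

private
  variable
    h h₁ h₂ : ℕ → ℕ
    a b c N M : ℕ

module _ {s ℓ} (S : Setoid s ℓ) where
  open Setoid S using (_≉_)
  open SetoidMembership S using () renaming (_∈_ to _∈ₛ_)
  open SetoidSubset S using (_⊆_)
  open SetoidUnique S using (Unique)
  open Membership# S using () renaming (_∈_ to _∈#_)

  ∈-fromList⁻ : ∀ {x xs} (u : AllPairs _≉_ xs) → x ∈# List#.fromList u → x ∈ₛ xs
  ∈-fromList⁻ (_ ∷ u) (here x≈y) = here x≈y
  ∈-fromList⁻ (_ ∷ u) (there p)  = there (∈-fromList⁻ u p)

  ∈-fromList⁺ : ∀ {x xs} (u : AllPairs _≉_ xs) → x ∈ₛ xs → x ∈# List#.fromList u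
  ∈-fromList⁺ (_ ∷ u) (here x≈y) = here x≈y
  ∈-fromList⁺ (_ ∷ u) (there p)  = there (∈-fromList⁺ u p)

  length-fromList : ∀ {xs} (u : AllPairs _≉_ xs) → List#.length (List#.fromList u) ≡ length xs
  length-fromList []      = refl
  length-fromList (_ ∷ u) = cong suc (length-fromList u)

  Unique-⊆⇒length≤ : ∀ {xs ys} → Unique xs → Unique ys → xs ⊆ ys → length xs ≤ length ys
  Unique-⊆⇒length≤ xs! ys! xs⊆ys =
    subst₂ _≤_ (length-fromList xs!) (length-fromList ys!)
      (injection S id (∈-fromList⁺ ys! ∘ xs⊆ys ∘ ∈-fromList⁻ xs!))

iter-+ : ∀ h i j x → iter h (i + j) x ≡ iter h i (iter h j x)
iter-+ h zero    j x = refl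
iter-+ h (suc i) j x = cong h (iter-+ h i j x)

iter-comm : ∀ h i j x → iter h i (iter h j x) ≡ iter h j (iter h i x)
iter-comm h i j x = begin
  iter h i (iter h j x) ≡⟨ iter-+ h i j x ⟨
  iter h (i + j) x      ≡⟨ cong (λ k → iter h k x) (+-comm i j) ⟩
  iter h (j + i) x      ≡⟨ iter-+ h j i x ⟩
  iter h j (iter h i x) ∎
  where open ≡-Reasoning

iter-injective : Injective _≡_ _≡_ h → ∀ k → Injective _≡_ _≡_ (iter h k)
iter-injective inj zero    e = e
iter-injective inj (suc k) e = iter-injective inj k (inj e)

InOrbit-refl : InOrbit h a a
InOrbit-refl = 0 , inj₁ refl

InOrbit-sym : InOrbit h a b → InOrbit h b a
InOrbit-sym (k , inj₁ e) = k , inj₂ e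
InOrbit-sym (k , inj₂ e) = k , inj₁ e

-- For an injection, lying in one orbit means having a common iterate, which makes
-- transitivity a calculation with iterates.
InOrbit⇒common-iterate : InOrbit h a b → ∃₂ λ i j → iter h i a ≡ iter h j b
InOrbit⇒common-iterate (k , inj₁ e) = k , 0 , e
InOrbit⇒common-iterate (k , inj₂ e) = 0 , k , sym e

common-iterate⇒InOrbit-≤ : Injective _≡_ _≡_ h → ∀ {i j} → i ≤ j →
                           iter h i a ≡ iter h j b → InOrbit h a b
common-iterate⇒InOrbit-≤ {h} {b = b} inj {i} i≤j e with d , refl ← m≤n⇒∃[o]m+o≡n i≤j =
  d , inj₂ (sym (iter-injective inj i (trans e (iter-+ h i d b))))

common-iterate⇒InOrbit : Injective _≡_ _≡_ h → ∀ i j → iter h i a ≡ iter h j b → InOrbit h a b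
common-iterate⇒InOrbit inj i j e with ≤-total i j
... | inj₁ i≤j = common-iterate⇒InOrbit-≤ inj i≤j e
... | inj₂ j≤i = InOrbit-sym (common-iterate⇒InOrbit-≤ inj j≤i (sym e))

InOrbit-trans : Injective _≡_ _≡_ h → InOrbit h a b → InOrbit h b c → InOrbit h a c
InOrbit-trans {h} {a} {b} {c} inj ab bc
  with i , j , e₁ ← InOrbit⇒common-iterate ab | k , l , e₂ ← InOrbit⇒common-iterate bc =
  common-iterate⇒InOrbit inj (k + i) (j + l) (begin
    iter h (k + i) a      ≡⟨ iter-+ h k i a ⟩
    iter h k (iter h i a) ≡⟨ cong (iter h k) e₁ ⟩
    iter h k (iter h j b) ≡⟨ iter-comm h k j b ⟩
    iter h j (iter h k b) ≡⟨ cong (iter h j) e₂ ⟩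
    iter h j (iter h l c) ≡⟨ iter-+ h j l c ⟨
    iter h (j + l) c      ∎)
  where open ≡-Reasoning

orbitSetoid : (h : ℕ → ℕ) → Injective _≡_ _≡_ h → Setoid 0ℓ 0ℓ
orbitSetoid h inj = record
  { Carrier       = ℕ
  ; _≈_           = InOrbit h
  ; isEquivalence = record { refl = InOrbit-refl ; sym = InOrbit-sym ; trans = InOrbit-trans inj }
  }

MeetsAllOrbitsOfLength : (ℕ → ℕ) → ℕ → List ℕ → Set
MeetsAllOrbitsOfLength h c rs = ∀ m → HasSize (InOrbit h m) c → ∃ λ r → r ∈ rs × InOrbit h r m

module _ (inj : Injective _≡_ _≡_ h) where
  open SetoidSubset (orbitSetoid h inj) using (_⊆_)

  representatives-⊆ : ∀ {rs ss} → All (λ r → HasSize (InOrbit h r) c) rs →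
    MeetsAllOrbitsOfLength h c ss → rs ⊆ ss
  representatives-⊆ sized meets x∈rs
    with size , x~r ← All.lookupAny sized x∈rs
    with s , s∈ss , s~r ← meets _ size =
    Membership.lose s∈ss (InOrbit-trans inj x~r (InOrbit-sym s~r))

  NumOrbitsOfLength-unique : NumOrbitsOfLength h c N → NumOrbitsOfLength h c M → N ≡ M
  NumOrbitsOfLength-unique (rs , rs-sized , rs! , rs-meets , refl)
                           (ss , ss-sized , ss! , ss-meets , refl) =
    ≤-antisym (Unique-⊆⇒length≤ S rs! ss! (representatives-⊆ rs-sized ss-meets))
              (Unique-⊆⇒length≤ S ss! rs! (representatives-⊆ ss-sized rs-meets))
    where S = orbitSetoid h inj

Intertwines : (φ h₁ h₂ : ℕ → ℕ) → Set
Intertwines φ h₁ h₂ = ∀ x → φ (h₁ x) ≡ h₂ (φ x)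

iter-intertwines : ∀ {φ} → Intertwines φ h₁ h₂ → ∀ k x → φ (iter h₁ k x) ≡ iter h₂ k (φ x)
iter-intertwines φh₁≗h₂φ zero    x = refl
iter-intertwines {h₁} {h₂} φh₁≗h₂φ (suc k) x =
  trans (φh₁≗h₂φ (iter h₁ k x)) (cong h₂ (iter-intertwines φh₁≗h₂φ k x))

InOrbit-intertwines : ∀ {φ} → Intertwines φ h₁ h₂ → InOrbit h₁ a b → InOrbit h₂ (φ a) (φ b)
InOrbit-intertwines {φ = φ} φh₁≗h₂φ (k , inj₁ e) =
  k , inj₁ (trans (sym (iter-intertwines φh₁≗h₂φ k _)) (cong φ e))
InOrbit-intertwines {φ = φ} φh₁≗h₂φ (k , inj₂ e) =
  k , inj₂ (trans (sym (iter-intertwines φh₁≗h₂φ k _)) (cong φ e))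

record Conjugacy (h₁ h₂ : ℕ → ℕ) : Set where
  field
    bijection   : ℕ ↔ ℕ
    intertwines : Intertwines (Inverse.to bijection) h₁ h₂

Conjugacy-sym : Conjugacy h₁ h₂ → Conjugacy h₂ h₁
Conjugacy-sym {h₁} {h₂} C = record { bijection = ↔-sym bijection ; intertwines = inverse-intertwines }
  where
  open Conjugacy C
  open Inverse bijection using (to; from; strictlyInverseˡ; strictlyInverseʳ)
  open ≡-Reasoning
  inverse-intertwines : Intertwines from h₂ h₁
  inverse-intertwines y = begin
    from (h₂ y)              ≡⟨ cong (from ∘ h₂) (strictlyInverseˡ y) ⟨
    from (h₂ (to (from y)))  ≡⟨ cong from (intertwines (from y)) ⟨
    from (to (h₁ (from y)))  ≡⟨ strictlyInverseʳ (h₁ (from y)) ⟩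
    h₁ (from y)              ∎

HasSize-↔ : ∀ {P Q : ℕ → Set} (φ : ℕ ↔ ℕ) → (∀ x → P x ⇔ Q (Inverse.to φ x)) →
            HasSize P c → HasSize Q c
HasSize-↔ {P = P} {Q} φ P⇔Q∘to (xs , xs! , members , size) =
  map to xs , Unique.map⁺ (Injection.injective (↔⇒↣ φ)) xs! , members′ ,
  trans (length-map to xs) size
  where
  open Inverse φ using (to; from; strictlyInverseˡ)
  members′ : ∀ y → (y ∈ map to xs → Q y) × (Q y → y ∈ map to xs)
  members′ y = image⇒Q , Q⇒image
    where
    image⇒Q : y ∈ map to xs → Q y
    image⇒Q y∈ with x , x∈xs , refl ← ∈-map⁻ to y∈ =
      Equivalence.to (P⇔Q∘to x) (proj₁ (members x) x∈xs)
    Q⇒image : Q y → y ∈ map to xs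
    Q⇒image qy = subst (_∈ map to xs) (strictlyInverseˡ y)
      (∈-map⁺ to (proj₂ (members (from y))
        (Equivalence.from (P⇔Q∘to (from y)) (subst Q (sym (strictlyInverseˡ y)) qy))))

module _ (C : Conjugacy h₁ h₂) where
  open Conjugacy C
  open Inverse bijection using (to; from; strictlyInverseˡ; strictlyInverseʳ)

  InOrbit-conjugacy : InOrbit h₁ a b ⇔ InOrbit h₂ (to a) (to b)
  InOrbit-conjugacy {a} {b} = mk⇔ (InOrbit-intertwines intertwines)
    (subst₂ (InOrbit h₁) (strictlyInverseʳ a) (strictlyInverseʳ b)
      ∘ InOrbit-intertwines (Conjugacy.intertwines (Conjugacy-sym C)))

  HasSize-orbit-conjugacy : HasSize (InOrbit h₁ a) c → HasSize (InOrbit h₂ (to a)) c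
  HasSize-orbit-conjugacy = HasSize-↔ bijection (λ _ → InOrbit-conjugacy)

module _ (C : Conjugacy h₁ h₂) where
  open Conjugacy C
  open Inverse bijection using (to; from; strictlyInverseˡ)

  AllOrbitsFinite-conjugacy : AllOrbitsFinite h₁ → AllOrbitsFinite h₂
  AllOrbitsFinite-conjugacy finite n =
    map₂ (subst (λ a → HasSize (InOrbit h₂ a) _) (strictlyInverseˡ n) ∘ HasSize-orbit-conjugacy C)
         (finite (from n))

  MeetsAllOrbitsOfLength-conjugacy : ∀ {rs} → MeetsAllOrbitsOfLength h₁ c rs →
                                     MeetsAllOrbitsOfLength h₂ c (map to rs)
  MeetsAllOrbitsOfLength-conjugacy meets m size
    with r , r∈rs , r~m ← meets (from m) (HasSize-orbit-conjugacy (Conjugacy-sym C) size) =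
    to r , ∈-map⁺ to r∈rs ,
    subst (InOrbit h₂ (to r)) (strictlyInverseˡ m) (Equivalence.to (InOrbit-conjugacy C) r~m)

  FinitelyManyOrbitsOfEachLength-conjugacy :
    FinitelyManyOrbitsOfEachLength h₁ → FinitelyManyOrbitsOfEachLength h₂
  FinitelyManyOrbitsOfEachLength-conjugacy finitelyMany c =
    let rs , meets = finitelyMany c in map to rs , MeetsAllOrbitsOfLength-conjugacy meets

  NumOrbitsOfLength-conjugacy : NumOrbitsOfLength h₁ c N → NumOrbitsOfLength h₂ c N
  NumOrbitsOfLength-conjugacy (rs , sized , rs! , meets , size) =
    map to rs ,
    All.map⁺ (All.map (HasSize-orbit-conjugacy C) sized) ,
    AllPairs.map⁺ (AllPairs.map (λ r≁s → r≁s ∘ Equivalence.from (InOrbit-conjugacy C)) rs!) ,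
    MeetsAllOrbitsOfLength-conjugacy meets ,
    trans (length-map to rs) size

corollary4p14 : (f g : ℕ ⤖ ℕ) →
    AllOrbitsFinite (Bijection.to f ∘ Bijection.to g) →
    FinitelyManyOrbitsOfEachLength (Bijection.to f ∘ Bijection.to g) →
    AllOrbitsFinite (Bijection.to g ∘ Bijection.to f) ×
    FinitelyManyOrbitsOfEachLength (Bijection.to g ∘ Bijection.to f) ×
    (∀ i p → IsNthPrime i p → ∀ N M →
      NumOrbitsOfLength (Bijection.to f ∘ Bijection.to g) p N →
      NumOrbitsOfLength (Bijection.to g ∘ Bijection.to f) p M →
      N % 2 ≡ M % 2)
corollary4p14 f g finite finitelyMany =
  AllOrbitsFinite-conjugacy g-conjugacy finite ,
  FinitelyManyOrbitsOfEachLength-conjugacy g-conjugacy finitelyMany ,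
  λ _ _ _ _ _ fg-orbits gf-orbits →
    cong (_% 2) (NumOrbitsOfLength-unique gf-injective
                  (NumOrbitsOfLength-conjugacy g-conjugacy fg-orbits) gf-orbits)
  where
  g-conjugacy : Conjugacy (Bijection.to f ∘ Bijection.to g) (Bijection.to g ∘ Bijection.to f)
  g-conjugacy = record { bijection = ⤖⇒↔ g ; intertwines = λ _ → refl }
  gf-injective : Injective _≡_ _≡_ (Bijection.to g ∘ Bijection.to f)
  gf-injective = Bijection.injective f ∘ Bijection.injective g
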